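{- Let $A, B, C, D$ be arbitrary formulas and let $\alpha, \beta, \gamma, \xi$ be heap labels. Then the following two entailments hold: \[ (@_{\alpha} A \circledast @_{\beta} B) * (@_{\gamma} C \circledast @_{\xi} D) \;\models\; (@_{\alpha} A * @_{\gamma} C) \circledast (@_{\beta} B * @_{\xi} D) \,\land\, (\alpha \mathrel{\overline{\circ}} \beta) \perp (\gamma \mathrel{\overline{\circ}} \xi), \] \[ (@_{\alpha} A * @_{\gamma} C) \circledast (@_{\beta} B * @_{\xi} D) \,\land\, (\alpha \mathrel{\overline{\circ}} \beta) \perp (\gamma \mathrel{\overline{\circ}} \xi) \;\models\; (@_{\alpha} A \circledast @_{\beta} B) * (@_{\gamma} C \circledast @_{\xi} D). \]
   Context: Setting (separation logic with labels and permissions). Fix a set $\mathsf{Val}$ of values, a set $\mathsf{Loc}\subseteq \mathsf{Val}$ of locations, a set of program variables, and a set $\mathsf{Label}$ of label variables. A permission algebra $\langle \mathsf{Perm},\oplus,\otimes,\top\rangle$ is given: $\oplus$ is a partial binary operation making $\langle\mathsf{Perm},\oplus\rangle$ a partial cancellative commutative semigroup (with divisibility: every $\pi$ equals $\pi_1\oplus\pi_2$ for some $\pi_1,\pi_2$; $\pi\oplus\top$ is undefined for all $\pi$; no unit: $\pi_1\neq\pi_1\oplus\pi_2$), $\otimes$ is a total binary operation, and $(\pi_1\oplus\pi_2)\otimes\pi=(\pi_1\otimes\pi)\oplus(\pi_2\otimes\pi)$. A stack $s$ maps variables to values. A p-heap is a finite partial function $h:\mathsf{Loc}\rightharpoonup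 \mathsf{Val}\times\mathsf{Perm}$; $\mathrm{dom}(h)$ is its domain. Two p-heaps are disjoint if their domains are disjoint. Strong composition $h_1\circ h_2$ is defined only if $h_1,h_2$ are disjoint, and is then their union. Weak composition $h_1\mathrel{\overline{\circ}} h_2$ is defined iff for every $\ell\in\mathrm{dom}(h_1)\cap\mathrm{dom}(h_2)$, $h_1(\ell)=(v,\pi_1)$, $h_2(\ell)=(v,\pi_2)$ with the same $v$ and $\pi_1\oplus\pi_2$ defined; then $(h_1\mathrel{\overline{\circ}} h_2)(\ell)=h_i(\ell)$ if $\ell$ is only in $\mathrm{dom}(h_i)$, and $=(v,\pi_1\oplus\pi_2)$ on the overlap. For a permission $\pi$, $(\pi\cdot h)(\ell)=(v,\pi\otimes\pi')$ whenever $h(\ell)=(v,\pi')$. A valuation $\rho$ assigns a p-heap $\rho(\alpha)$ to each label $\alpha$, extended to label terms by $\rho(l_1\circ l_2)=\rho(l_1)\circ\rho(l_2)$, $\rho(l_1\mathrel{\overline{\circ}} l_2)=\rho(l_1)\mathrel{\overline{\circ}}\rho(l_2)$, $\rho(l^\pi)=\pi\cdot\rho(l)$ (possibly undefined). The pure label constraint $l_1\perp l_2$ holds under $\rho$ iff $\rho(l_1)$ and $\rho(l_2)$ are (defined and) disjoint. Formulas are interpreted by a satisfaction relation $s,h,\rho\models\Phi$, where: $s,h,\rho\models A_1*A_2$ iff $h=h_1\circ h_2$ for some $h_1,h_2$ with $s,h_i,\rho\models A_i$; $s,h,\rho\models A_1\circledast A_2$ iff $h=h_1\mathrel{\overline{\circ}}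 h_2$ for some $h_1,h_2$ with $s,h_i,\rho\models A_i$; $s,h,\rho\models @_\alpha A$ iff $h=\rho(\alpha)$ and $s,\rho(\alpha),\rho\models A$; $s,h,\rho\models A^\pi$ iff $h=\pi\cdot h'$ for some $h'$ with $s,h',\rho\models A$; $s,h,\rho\models \Phi\land p$ for a pure constraint $p$ iff $s,h,\rho\models\Phi$ and $p$ holds under $s,\rho$. Entailment $\Phi\models\Psi$ means: for all $s,h,\rho$, if $s,h,\rho\models\Phi$ then $s,h,\rho\models\Psi$. -}

module Defs where

open import Data.Maybe using (Maybe; just; nothing; _>>=_)
open import Data.Product using (Σ; ∃; _×_; _,_)
open import Data.List using (List)
open import Data.Sum using (_⊎_)
open import Data.List.Membership.Propositional using (_∈_)
open import Relation.Binary.PropositionalEquality using (_≡_; _≢_)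

record PermAlgebra : Set₁ where
  field
    Perm  : Set
    _⊕_   : Perm → Perm → Maybe Perm
    _⊗_   : Perm → Perm → Perm
    ⊤     : Perm
    ⊕-comm   : ∀ a b → a ⊕ b ≡ b ⊕ a
    ⊕-assoc  : ∀ a b c → ((a ⊕ b) >>= λ ab → ab ⊕ c) ≡ ((b ⊕ c) >>= λ bc → a ⊕ bc)
    ⊕-cancel : ∀ a b c d → a ⊕ b ≡ just d → a ⊕ c ≡ just d → b ≡ c
    ⊕-div    : ∀ π → Σ Perm λ π₁ → Σ Perm λ π₂ → π₁ ⊕ π₂ ≡ just π
    ⊕-top    : ∀ π → π ⊕ ⊤ ≡ nothing
    ⊕-nounit : ∀ π₁ π₂ → π₁ ⊕ π₂ ≢ just π₁
    ⊗-distr  : ∀ π₁ π₂ π₁₂ π → π₁ ⊕ π₂ ≡ just π₁₂ →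
               (π₁ ⊗ π) ⊕ (π₂ ⊗ π) ≡ just (π₁₂ ⊗ π)

-- Semantics, parametric in variables, values, locations (with Loc ⊆ Val
-- given by an injection-like map) and labels.
module Sem (Var Val Loc Label : Set) (locVal : Loc → Val) (PA : PermAlgebra) where
  open PermAlgebra PA

  infixr 6 _✱_ _⊛_
  infix 8 ⓐ[_]_
  infixl 4 _∧ₚ_
  infix 2 _⊨_
  infixl 7 _ōₗ_ _∘ₗ_
  infix 5 _⊥ₗ_

  Cell : Set
  Cell = Maybe (Val × Perm)

  record Heap : Set where
    constructor mkHeap
    field
      _at_   : Loc → Cell
      finite : Σ (List Loc) λ L → ∀ ℓ → _at_ ℓ ≢ nothing → ℓ ∈ L
  open Heap public

  Stack : Set
  Stack = Var → Val

  Valuation : Set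
  Valuation = Label → Heap

  _≐_ : Heap → Heap → Set
  h ≐ h' = ∀ ℓ → h at ℓ ≡ h' at ℓ

  Disjoint : Heap → Heap → Set
  Disjoint h₁ h₂ = ∀ ℓ → h₁ at ℓ ≡ nothing ⊎ h₂ at ℓ ≡ nothing

  -- cell-wise strong composition: StrongCell c₁ c₂ c  means  c₁ ∘ c₂ defined and = c
  data StrongCell : Cell → Cell → Cell → Set where
    none  : StrongCell nothing nothing nothing
    left  : ∀ x → StrongCell (just x) nothing (just x)
    right : ∀ x → StrongCell nothing (just x) (just x)

  data WeakCell : Cell → Cell → Cell → Set where
    none  : WeakCell nothing nothing nothing
    left  : ∀ x → WeakCell (just x) nothing (just x)
    right : ∀ x → WeakCell nothing (just x) (just x)
    both  : ∀ v π₁ π₂ π → π₁ ⊕ π₂ ≡ just π →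
            WeakCell (just (v , π₁)) (just (v , π₂)) (just (v , π))

  data ScaleCell (π : Perm) : Cell → Cell → Set where
    none : ScaleCell π nothing nothing
    some : ∀ v π' → ScaleCell π (just (v , π')) (just (v , π ⊗ π'))

  StrongComp : Heap → Heap → Heap → Set
  StrongComp h₁ h₂ h = ∀ ℓ → StrongCell (h₁ at ℓ) (h₂ at ℓ) (h at ℓ)

  WeakComp : Heap → Heap → Heap → Set
  WeakComp h₁ h₂ h = ∀ ℓ → WeakCell (h₁ at ℓ) (h₂ at ℓ) (h at ℓ)

  Scale : Perm → Heap → Heap → Set
  Scale π h' h = ∀ ℓ → ScaleCell π (h' at ℓ) (h at ℓ)

  data LTerm : Set where
    var   : Label → LTerm
    _∘ₗ_  : LTerm → LTerm → LTerm
    _ōₗ_  : LTerm → LTerm → LTerm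
    _^ₗ_  : LTerm → Perm → LTerm

  -- ρ(l) is defined and equals h
  Den : Valuation → LTerm → Heap → Set
  Den ρ (var α)   h = ρ α ≐ h
  Den ρ (l₁ ∘ₗ l₂) h = Σ Heap λ h₁ → Σ Heap λ h₂ → Den ρ l₁ h₁ × Den ρ l₂ h₂ × StrongComp h₁ h₂ h
  Den ρ (l₁ ōₗ l₂) h = Σ Heap λ h₁ → Σ Heap λ h₂ → Den ρ l₁ h₁ × Den ρ l₂ h₂ × WeakComp h₁ h₂ h
  Den ρ (l ^ₗ π)   h = Σ Heap λ h' → Den ρ l h' × Scale π h' h

  _⊥ₗ_ : LTerm → LTerm → Valuation → Set
  (l₁ ⊥ₗ l₂) ρ = Σ Heap λ h₁ → Σ Heap λ h₂ → Den ρ l₁ h₁ × Den ρ l₂ h₂ × Disjoint h₁ h₂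

  Formula : Set₁
  Formula = Stack → Heap → Valuation → Set

  _✱_ : Formula → Formula → Formula
  (A₁ ✱ A₂) s h ρ = Σ Heap λ h₁ → Σ Heap λ h₂ → StrongComp h₁ h₂ h × A₁ s h₁ ρ × A₂ s h₂ ρ

  _⊛_ : Formula → Formula → Formula
  (A₁ ⊛ A₂) s h ρ = Σ Heap λ h₁ → Σ Heap λ h₂ → WeakComp h₁ h₂ h × A₁ s h₁ ρ × A₂ s h₂ ρ

  ⓐ[_]_ : Label → Formula → Formula
  (ⓐ[ α ] A) s h ρ = (h ≐ ρ α) × A s (ρ α) ρ

  _^_ : Formula → Perm → Formula
  (A ^ π) s h ρ = Σ Heap λ h' → Scale π h' h × A s h' ρ

  _∧ₚ_ : Formula → (Valuation → Set) → Formula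
  (Φ ∧ₚ p) s h ρ = Φ s h ρ × p ρ

  _⊨_ : Formula → Formula → Set
  Φ ⊨ Ψ = ∀ s h ρ → Φ s h ρ → Ψ s h ρ

module Submission where

-- Strong and weak composition satisfy an interchange law, location by location: if
-- h = (a ō b) ∘ (c ō d) then the two strong composites a ∘ c and b ∘ d exist and
-- h = (a ∘ c) ō (b ∘ d); conversely, (a ∘ c) ō (b ∘ d) equals (a ō b) ∘ (c ō d) as
-- soon as a ō b and c ō d are disjoint, since then at every location one side of
-- the weak composition is empty. Labelled formulas pin the four heaps down to
-- ρ α, ρ β, ρ γ, ρ ξ, so both entailments reduce to this law.

open import Defs
open import Data.Product using (_×_; _,_; proj₁; proj₂)
open import Data.Maybe using (just; nothing; _<∣>_)
open import Data.Sum using (_⊎_; inj₁; inj₂)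
open import Data.List using (List; _++_)
open import Data.List.Membership.Propositional.Properties using (∈-++⁺ˡ; ∈-++⁺ʳ)
open import Data.List.Membership.Propositional using (_∈_)
open import Function using (case_of_)
open import Relation.Binary.PropositionalEquality
  using (_≡_; _≢_; refl; sym; trans)

module Interchange (Var Val Loc Label : Set) (locVal : Loc → Val) (PA : PermAlgebra) where
  open Sem Var Val Loc Label locVal PA

  private
    variable
      a b c d x y z H₁ H₂ : Cell

  strongCell-unitʳ : ∀ x → StrongCell x nothing x
  strongCell-unitʳ nothing  = none
  strongCell-unitʳ (just x) = left x

  strongCell-unitˡ : ∀ x → StrongCell nothing x x
  strongCell-unitˡ nothing  = none
  strongCell-unitˡ (just x) = right x

  strongCell-identityʳ : StrongCell a nothing z → a ≡ z
  strongCell-identityʳ none     = refl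
  strongCell-identityʳ (left _) = refl

  strongCell-identityˡ : StrongCell nothing a z → a ≡ z
  strongCell-identityˡ none      = refl
  strongCell-identityˡ (right _) = refl

  strongCell-disjoint : StrongCell x y z → x ≡ nothing ⊎ y ≡ nothing
  strongCell-disjoint none      = inj₁ refl
  strongCell-disjoint (left _)  = inj₂ refl
  strongCell-disjoint (right _) = inj₁ refl

  weakCell-functional : WeakCell a b x → WeakCell a b y → x ≡ y
  weakCell-functional none      none      = refl
  weakCell-functional (left _)  (left _)  = refl
  weakCell-functional (right _) (right _) = refl
  weakCell-functional (both _ _ _ _ e) (both _ _ _ _ e′) with trans (sym e) e′
  ... | refl = refl

  weakCell-nothing⁻¹ : WeakCell a b nothing → a ≡ nothing × b ≡ nothing
  weakCell-nothing⁻¹ none = refl , refl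

  interchangeᶜ : WeakCell a b x → WeakCell c d y → StrongCell x y z →
                 StrongCell a c (a <∣> c) × StrongCell b d (b <∣> d) ×
                 WeakCell (a <∣> c) (b <∣> d) z
  interchangeᶜ none               none               none      = none , none , none
  interchangeᶜ (left x)           none               (left _)  = left x , none , left x
  interchangeᶜ (right x)          none               (left _)  = none , left x , right x
  interchangeᶜ (both v π₁ π₂ π e) none               (left _)  = left _ , left _ , both v π₁ π₂ π e
  interchangeᶜ none               (left x)           (right _) = right x , none , left x
  interchangeᶜ none               (right x)          (right _) = none , right x , right x
  interchangeᶜ none               (both v π₁ π₂ π e) (right _) = right _ , right _ , both v π₁ π₂ π e

  interchangeᶜ⁻¹ : WeakCell a b x → WeakCell c d y → x ≡ nothing ⊎ y ≡ nothing →
                   StrongCell a c H₁ → StrongCell b d H₂ → WeakCell H₁ H₂ z →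
                   StrongCell x y z
  interchangeᶜ⁻¹ wab wcd (inj₂ refl) sac sbd w
    with refl , refl ← weakCell-nothing⁻¹ wcd
    with refl ← strongCell-identityʳ sac | refl ← strongCell-identityʳ sbd
    with refl ← weakCell-functional wab w = strongCell-unitʳ _
  interchangeᶜ⁻¹ wab wcd (inj₁ refl) sac sbd w
    with refl , refl ← weakCell-nothing⁻¹ wab
    with refl ← strongCell-identityˡ sac | refl ← strongCell-identityˡ sbd
    with refl ← weakCell-functional wcd w = strongCell-unitˡ _

  _∪_ : Heap → Heap → Heap
  h₁ ∪ h₂ = mkHeap (λ ℓ → h₁ at ℓ <∣> h₂ at ℓ) (L₁ ++ L₂ , covered)
    where
    L₁ L₂ : List Loc
    L₁ = proj₁ (finite h₁)
    L₂ = proj₁ (finite h₂)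
    covered : ∀ ℓ → h₁ at ℓ <∣> h₂ at ℓ ≢ nothing → ℓ ∈ L₁ ++ L₂
    covered ℓ defined with h₁ at ℓ in eq
    ... | just _  = ∈-++⁺ˡ (proj₂ (finite h₁) ℓ λ undefined → case trans (sym eq) undefined of λ ())
    ... | nothing = ∈-++⁺ʳ L₁ (proj₂ (finite h₂) ℓ defined)

  weakCell-resp : ∀ {a′ b′} → a ≡ a′ → b ≡ b′ → WeakCell a b z → WeakCell a′ b′ z
  weakCell-resp refl refl w = w

  strongCell-resp : ∀ {a′ b′} → a ≡ a′ → b ≡ b′ → StrongCell a b z → StrongCell a′ b′ z
  strongCell-resp refl refl s = s

  -- Heap arguments are explicit from here on: a relation such as WeakComp a b h only
  -- constrains the cells of a and b, never their finiteness witnesses, so they cannot be inferred.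
  strongComp-disjoint : (x y z : Heap) → StrongComp x y z → Disjoint x y
  strongComp-disjoint _ _ _ s ℓ = strongCell-disjoint (s ℓ)

  interchange : (a b c d x y z : Heap) →
                WeakComp a b x → WeakComp c d y → StrongComp x y z →
                StrongComp a c (a ∪ c) × StrongComp b d (b ∪ d) × WeakComp (a ∪ c) (b ∪ d) z
  interchange a b c d _ _ z wab wcd s =
      (λ ℓ → proj₁ (cells ℓ))
    , (λ ℓ → proj₁ (proj₂ (cells ℓ)))
    , (λ ℓ → proj₂ (proj₂ (cells ℓ)))
    where
    cells : ∀ ℓ → StrongCell (a at ℓ) (c at ℓ) ((a ∪ c) at ℓ) ×
                  StrongCell (b at ℓ) (d at ℓ) ((b ∪ d) at ℓ) ×
                  WeakCell ((a ∪ c) at ℓ) ((b ∪ d) at ℓ) (z at ℓ)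
    cells ℓ = interchangeᶜ (wab ℓ) (wcd ℓ) (s ℓ)

  interchange⁻¹ : (a b c d x y H₁ H₂ z : Heap) →
                  WeakComp a b x → WeakComp c d y → Disjoint x y →
                  StrongComp a c H₁ → StrongComp b d H₂ → WeakComp H₁ H₂ z → StrongComp x y z
  interchange⁻¹ _ _ _ _ _ _ _ _ _ wab wcd x⊥y sac sbd w ℓ =
    interchangeᶜ⁻¹ (wab ℓ) (wcd ℓ) (x⊥y ℓ) (sac ℓ) (sbd ℓ) (w ℓ)

  module _ (A B C D : Formula) (α β γ ξ : Label) where

    ⓐ-interchange : ((ⓐ[ α ] A ⊛ ⓐ[ β ] B) ✱ (ⓐ[ γ ] C ⊛ ⓐ[ ξ ] D))
                    ⊨ (((ⓐ[ α ] A ✱ ⓐ[ γ ] C) ⊛ (ⓐ[ β ] B ✱ ⓐ[ ξ ] D))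
                        ∧ₚ ((var α ōₗ var β) ⊥ₗ (var γ ōₗ var ξ)))
    ⓐ-interchange s h ρ (h₁ , h₂ , s₁₂ , (_ , _ , w₁ , (eα , pA) , (eβ , pB))
                                       , (_ , _ , w₂ , (eγ , pC) , (eξ , pD))) =
      let sαγ , sβξ , w = interchange (ρ α) (ρ β) (ρ γ) (ρ ξ) h₁ h₂ h wαβ wγξ s₁₂
      in  ( ρ α ∪ ρ γ , ρ β ∪ ρ ξ , w
          , (ρ α , ρ γ , sαγ , ((λ _ → refl) , pA) , ((λ _ → refl) , pC))
          , (ρ β , ρ ξ , sβξ , ((λ _ → refl) , pB) , ((λ _ → refl) , pD)) )
        , ( h₁ , h₂
          , (ρ α , ρ β , (λ _ → refl) , (λ _ → refl) , wαβ)
          , (ρ γ , ρ ξ , (λ _ → refl) , (λ _ → refl) , wγξ)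
          , strongComp-disjoint h₁ h₂ h s₁₂ )
      where
      wαβ : WeakComp (ρ α) (ρ β) h₁
      wαβ ℓ = weakCell-resp (eα ℓ) (eβ ℓ) (w₁ ℓ)
      wγξ : WeakComp (ρ γ) (ρ ξ) h₂
      wγξ ℓ = weakCell-resp (eγ ℓ) (eξ ℓ) (w₂ ℓ)

    ⓐ-interchange⁻¹ : (((ⓐ[ α ] A ✱ ⓐ[ γ ] C) ⊛ (ⓐ[ β ] B ✱ ⓐ[ ξ ] D))
                        ∧ₚ ((var α ōₗ var β) ⊥ₗ (var γ ōₗ var ξ)))
                      ⊨ ((ⓐ[ α ] A ⊛ ⓐ[ β ] B) ✱ (ⓐ[ γ ] C ⊛ ⓐ[ ξ ] D))
    ⓐ-interchange⁻¹ s h ρ ( (H₁ , H₂ , w , (_ , _ , s₁ , (eα , pA) , (eγ , pC))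
                                         , (_ , _ , s₂ , (eβ , pB) , (eξ , pD)))
                          , (k₁ , k₂ , (_ , _ , eα′ , eβ′ , w₁) , (_ , _ , eγ′ , eξ′ , w₂) , k₁⊥k₂) ) =
        k₁ , k₂
      , interchange⁻¹ (ρ α) (ρ β) (ρ γ) (ρ ξ) k₁ k₂ H₁ H₂ h wαβ wγξ k₁⊥k₂ sαγ sβξ w
      , (ρ α , ρ β , wαβ , ((λ _ → refl) , pA) , ((λ _ → refl) , pB))
      , (ρ γ , ρ ξ , wγξ , ((λ _ → refl) , pC) , ((λ _ → refl) , pD))
      where
      wαβ : WeakComp (ρ α) (ρ β) k₁
      wαβ ℓ = weakCell-resp (sym (eα′ ℓ)) (sym (eβ′ ℓ)) (w₁ ℓ)
      wγξ : WeakComp (ρ γ) (ρ ξ) k₂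
      wγξ ℓ = weakCell-resp (sym (eγ′ ℓ)) (sym (eξ′ ℓ)) (w₂ ℓ)
      sαγ : StrongComp (ρ α) (ρ γ) H₁
      sαγ ℓ = strongCell-resp (eα ℓ) (eγ ℓ) (s₁ ℓ)
      sβξ : StrongComp (ρ β) (ρ ξ) H₂
      sβξ ℓ = strongCell-resp (eβ ℓ) (eξ ℓ) (s₂ ℓ)

lemma1 : (Var Val Loc Label : Set) (locVal : Loc → Val) (PA : PermAlgebra) →
         let open Sem Var Val Loc Label locVal PA in
         (A B C D : Formula) (α β γ ξ : Label) →
         (((ⓐ[ α ] A ⊛ ⓐ[ β ] B) ✱ (ⓐ[ γ ] C ⊛ ⓐ[ ξ ] D))
            ⊨ (((ⓐ[ α ] A ✱ ⓐ[ γ ] C) ⊛ (ⓐ[ β ] B ✱ ⓐ[ ξ ] D))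
                 ∧ₚ ((var α ōₗ var β) ⊥ₗ (var γ ōₗ var ξ))))
         ×
         ((((ⓐ[ α ] A ✱ ⓐ[ γ ] C) ⊛ (ⓐ[ β ] B ✱ ⓐ[ ξ ] D))
                 ∧ₚ ((var α ōₗ var β) ⊥ₗ (var γ ōₗ var ξ)))
            ⊨ ((ⓐ[ α ] A ⊛ ⓐ[ β ] B) ✱ (ⓐ[ γ ] C ⊛ ⓐ[ ξ ] D)))
lemma1 Var Val Loc Label locVal PA A B C D α β γ ξ =
  ⓐ-interchange A B C D α β γ ξ , ⓐ-interchange⁻¹ A B C D α β γ ξ
  where open Interchange Var Val Loc Label locVal PA
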